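{- Let $n = 2k+1 \geq 3$ be odd. Every schedule for an asynchronous single round-robin tournament with $n$ teams that has guaranteed rest time $k-1$ has rest difference index $1$.
   Context: An asynchronous single round-robin tournament with $n$ teams is one in which every pair of distinct teams plays exactly once and no two games are simultaneous; a schedule is a linear ordering of the $\binom{n}{2}$ games. The guaranteed rest time of a schedule is the maximum integer $b$ such that any two games involving the same team are separated by at least $b$ games not involving that team. The rest difference index is the minimum integer $d$ such that for every game, if one of its teams has not played in $i_1$ consecutive games since its last game and the other in $i_2$ consecutive games since its last game, then $|i_1-i_2|\le d$; for a team playing its first game, all teams are deemed to have played in an imaginary game placed immediately before the first game of the schedule. -}

module Defs where

open import Data.Nat using (ℕ; zero; suc; _+_; _∸_; _≤_; _<_; ∣_-_∣)
open import Data.Fin using (Fin; toℕ) renaming (_<_ to _<ᶠ_)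
import Data.Fin as F
open import Data.Bool using (Bool; true; false; if_then_else_; _∨_)
open import Data.Product using (_×_; _,_; proj₁; proj₂)
open import Data.Sum using (_⊎_)
open import Data.List using (List; []; _∷_; length; lookup; take; reverse)
open import Data.List.Relation.Unary.All using (All)
open import Data.List.Relation.Unary.Unique.Propositional using (Unique)
open import Data.List.Membership.Propositional using (_∈_)
open import Relation.Binary.PropositionalEquality using (_≡_)
open import Relation.Nullary using (¬_; does)

-- A game between teams of Fin n, normalised as (i , j) with i < j.
Game : ℕ → Set
Game n = Fin n × Fin n

record IsSchedule {n : ℕ} (S : List (Game n)) : Set where
  field
    normalised : All (λ g → proj₁ g <ᶠ proj₂ g) S
    distinct   : Unique S
    complete   : ∀ (i j : Fin n) → i <ᶠ j → (i , j) ∈ S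

Involves : {n : ℕ} → Fin n → Game n → Set
Involves t g = t ≡ proj₁ g ⊎ t ≡ proj₂ g

involves? : {n : ℕ} → Fin n → Game n → Bool
involves? t g = does (t F.≟ proj₁ g) ∨ does (t F.≟ proj₂ g)

gapRev : {n : ℕ} → List (Game n) → Fin n → ℕ
gapRev [] t = 0
gapRev (g ∷ gs) t = if involves? t g then 0 else suc (gapRev gs t)

-- number of consecutive games immediately before position p not involving t
-- (if t has not played yet, this is p: the imaginary game sits just before
-- the first game of the schedule).
idle : {n : ℕ} (S : List (Game n)) → Fin (length S) → Fin n → ℕ
idle S p t = gapRev (reverse (take (toℕ p) S)) t

-- any two games involving the same team are separated by at least b games
-- not involving that team (stated for consecutive games of that team; the
-- games strictly between them then are exactly the ones not involving it).
RestAtLeast : {n : ℕ} → ℕ → List (Game n) → Set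
RestAtLeast {n} b S =
  ∀ (p q : Fin (length S)) (t : Fin n) → toℕ p < toℕ q →
  Involves t (lookup S p) → Involves t (lookup S q) →
  (∀ (r : Fin (length S)) → toℕ p < toℕ r → toℕ r < toℕ q → ¬ Involves t (lookup S r)) →
  b ≤ toℕ q ∸ toℕ p ∸ 1

HasGuaranteedRestTime : {n : ℕ} → ℕ → List (Game n) → Set
HasGuaranteedRestTime b S = RestAtLeast b S × (∀ b′ → RestAtLeast b′ S → b′ ≤ b)

RestDiffAtMost : {n : ℕ} → ℕ → List (Game n) → Set
RestDiffAtMost d S =
  ∀ (p : Fin (length S)) →
  ∣ idle S p (proj₁ (lookup S p)) - idle S p (proj₂ (lookup S p)) ∣ ≤ d

HasRestDifferenceIndex : {n : ℕ} → ℕ → List (Game n) → Set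
HasRestDifferenceIndex d S = RestDiffAtMost d S × (∀ d′ → RestDiffAtMost d′ S → d ≤ d′)

module Submission where

-- The module RestTimeKMinusOne then fixes n = 2K+1 and rest time K−1. There any
-- K consecutive games are pairwise disjoint, and by counting no such window
-- misses two distinct teams ('crowded').
--
-- For the game at position p: if p < K, neither team has played yet, so both
-- idle times are p and the difference is 0. If p = q + K, then by 'crowded' one
-- team x of game p also plays game q, so its idle time is K−1; the other team y
-- plays none of q, …, p−1, and by 'crowded' again it plays at q−1 (or q = 0),
-- so its idle time is K. Hence every difference is at most 1, and the game at
-- position K (which exists) has difference exactly 1.

open import Defs
open import Data.Nat using (ℕ; zero; suc; _+_; _*_; _∸_; _≤_; _<_; z≤n; s≤s; z<s; ∣_-_∣; _<?_)
open import Data.Nat.Properties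
open import Data.Fin using (Fin; toℕ; fromℕ<) renaming (_<_ to _<ᶠ_)
import Data.Fin as F
import Data.Fin.Properties as FP
open import Data.Fin.Induction using (<-wellFounded)
open import Induction.WellFounded using (Acc; acc)
open import Data.Bool using (true; false; if_then_else_)
open import Data.Product using (_×_; _,_; proj₁; proj₂; Σ; uncurry)
open import Data.Sum using (_⊎_; inj₁; inj₂)
open import Data.Empty using (⊥; ⊥-elim)
open import Function using (_∘′_)
open import Data.List using (List; length; lookup; take; reverse; [_])
open import Data.List.Properties using (take-suc; reverse-++)
import Data.List.Relation.Unary.All as All
open import Data.List.Relation.Unary.AllPairs using (_∷_)
import Data.List.Relation.Unary.Any as Any
open import Data.List.Relation.Unary.Any.Properties using (lookup-index)
open import Data.List.Relation.Unary.Unique.Propositional using (Unique)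
open import Data.List.Membership.Propositional using (_∈_)
open import Data.List.Membership.Propositional.Properties using (∈-lookup)
open import Relation.Binary.PropositionalEquality hiding ([_])
open ≡-Reasoning
open import Relation.Binary.Definitions using (tri<; tri≈; tri>)
open import Relation.Nullary using (¬_; Dec; yes; no)
open import Relation.Nullary.Decidable using (dec-true; dec-false; _⊎-dec_)

unique-lookup : ∀ {A : Set} {xs : List A} → Unique xs →
                (i j : Fin (length xs)) → i ≢ j → lookup xs i ≢ lookup xs j
unique-lookup (_ ∷ _) F.zero F.zero i≢j = ⊥-elim (i≢j refl)
unique-lookup (x∉ ∷ _) F.zero (F.suc j) _ = All.lookup x∉ (∈-lookup j)
unique-lookup (x∉ ∷ _) (F.suc i) F.zero _ e = All.lookup x∉ (∈-lookup i) (sym e)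
unique-lookup (_ ∷ u) (F.suc i) (F.suc j) i≢j = unique-lookup u i j (i≢j ∘′ cong F.suc)

module Games {n : ℕ} where

  involves-dec : (t : Fin n) (g : Game n) → Dec (Involves t g)
  involves-dec t g = (t F.≟ proj₁ g) ⊎-dec (t F.≟ proj₂ g)

  involves?-true : {t : Fin n} {g : Game n} → Involves t g → involves? t g ≡ true
  involves?-true {t} {g} = dec-true (involves-dec t g)

  involves?-false : {t : Fin n} {g : Game n} → ¬ Involves t g → involves? t g ≡ false
  involves?-false {t} {g} = dec-false (involves-dec t g)

  Disjoint : Game n → Game n → Set
  Disjoint g h = ∀ t → Involves t g → ¬ Involves t h

  team : Game n → Fin 2 → Fin n
  team g F.zero = proj₁ g
  team g (F.suc F.zero) = proj₂ g

  team-involved : (g : Game n) (b : Fin 2) → Involves (team g b) g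
  team-involved g F.zero = inj₁ refl
  team-involved g (F.suc F.zero) = inj₂ refl

  team-injective : (g : Game n) → proj₁ g ≢ proj₂ g →
                   (b b′ : Fin 2) → team g b ≡ team g b′ → b ≡ b′
  team-injective g proper F.zero F.zero _ = refl
  team-injective g proper F.zero (F.suc F.zero) e = ⊥-elim (proper e)
  team-injective g proper (F.suc F.zero) F.zero e = ⊥-elim (proper (sym e))
  team-injective g proper (F.suc F.zero) (F.suc F.zero) _ = refl

  orientation : {x y : Fin n} (g : Game n) → x ≢ y → Involves x g → Involves y g →
                (proj₁ g ≡ x × proj₂ g ≡ y) ⊎ (proj₁ g ≡ y × proj₂ g ≡ x)
  orientation g x≢y (inj₁ a) (inj₁ b) = ⊥-elim (x≢y (trans a (sym b)))
  orientation g x≢y (inj₁ a) (inj₂ b) = inj₁ (sym a , sym b)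
  orientation g x≢y (inj₂ a) (inj₁ b) = inj₂ (sym b , sym a)
  orientation g x≢y (inj₂ a) (inj₂ b) = ⊥-elim (x≢y (trans a (sym b)))

  same-teams⇒≡ : {x y : Fin n} (g h : Game n) → proj₁ g <ᶠ proj₂ g → proj₁ h <ᶠ proj₂ h →
                 x ≢ y → Involves x g → Involves y g → Involves x h → Involves y h → g ≡ h
  same-teams⇒≡ g h g< h< x≢y xg yg xh yh with orientation g x≢y xg yg | orientation h x≢y xh yh
  ... | inj₁ (refl , refl) | inj₁ (refl , refl) = refl
  ... | inj₂ (refl , refl) | inj₂ (refl , refl) = refl
  ... | inj₁ (refl , refl) | inj₂ (refl , refl) = ⊥-elim (<-asym g< h<)
  ... | inj₂ (refl , refl) | inj₁ (refl , refl) = ⊥-elim (<-asym g< h<)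

  team-outside : (g h : Game n) → proj₁ g <ᶠ proj₂ g → proj₁ h <ᶠ proj₂ h → g ≢ h →
                 Σ (Fin n) λ z → Involves z g × ¬ Involves z h
  team-outside g h g< h< g≢h with involves-dec (proj₁ g) h | involves-dec (proj₂ g) h
  ... | no ¬h₁ | _ = proj₁ g , inj₁ refl , ¬h₁
  ... | yes _ | no ¬h₂ = proj₂ g , inj₂ refl , ¬h₂
  ... | yes h₁ | yes h₂ =
    ⊥-elim (g≢h (same-teams⇒≡ g h g< h< (FP.<⇒≢ g<) (inj₁ refl) (inj₂ refl) h₁ h₂))

  disjoint-games-bound : {m : ℕ} (f : Fin m → Game n) → (∀ a → proj₁ (f a) ≢ proj₂ (f a)) →
                         (∀ {a a′} → a ≢ a′ → Disjoint (f a) (f a′)) → m * 2 ≤ n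
  disjoint-games-bound {m} f proper disjoint = FP.injective⇒≤ seat∘split-injective
    where
    seat : Fin m × Fin 2 → Fin n
    seat (a , b) = team (f a) b

    seat-injective : ∀ x y → seat x ≡ seat y → x ≡ y
    seat-injective (a , b) (a′ , b′) e with a F.≟ a′
    ... | yes refl = cong (a ,_) (team-injective (f a) (proper a) b b′ e)
    ... | no a≢a′ = ⊥-elim (disjoint a≢a′ _ (team-involved (f a) b)
                      (subst (λ t → Involves t (f a′)) (sym e) (team-involved (f a′) b′)))

    seat∘split-injective : ∀ {i j} → seat (F.remQuot {m} 2 i) ≡ seat (F.remQuot {m} 2 j) → i ≡ j
    seat∘split-injective {i} {j} e = begin
      i                                     ≡⟨ FP.combine-remQuot {m} 2 i ⟨
      uncurry F.combine (F.remQuot {m} 2 i) ≡⟨ cong (uncurry F.combine) (seat-injective _ _ e) ⟩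
      uncurry F.combine (F.remQuot {m} 2 j) ≡⟨ FP.combine-remQuot {m} 2 j ⟩
      j                                     ∎

open Games

Absent : {n : ℕ} (S : List (Game n)) → Fin n → ℕ → ℕ → Set
Absent S t s e = ∀ (r : Fin (length S)) → s ≤ toℕ r → toℕ r < e → ¬ Involves t (lookup S r)

strictly-between-< : ∀ r r′ b → r < r′ → r′ < r + suc b → r′ ∸ r ∸ 1 < b
strictly-between-< zero (suc r′) b _ (s≤s r′<b) = r′<b
strictly-between-< (suc r) (suc r′) b (s≤s r<r′) (s≤s r′<r+b′) = strictly-between-< r r′ b r<r′ r′<r+b′

∣n-1+n∣≡1 : ∀ m → ∣ m - suc m ∣ ≡ 1
∣n-1+n∣≡1 m = subst (λ x → ∣ m - x ∣ ≡ 1) (+-comm m 1) (∣m-m+n∣≡n m 1)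

within-window : ∀ {s a b w} → s ≤ a → b < s + w → b < a + w
within-window {w = w} s≤a b<s+w = <-≤-trans b<s+w (+-monoˡ-≤ w s≤a)

-- By well-founded induction on the later position r′: every
-- game strictly between r and r′ is closer to r, so it does not involve t, and
-- the rest condition applies to r and r′ directly.
rest-apart : {n b : ℕ} {S : List (Game n)} → RestAtLeast b S → (t : Fin n) →
             (r r′ : Fin (length S)) → toℕ r < toℕ r′ →
             Involves t (lookup S r) → Involves t (lookup S r′) → toℕ r + suc b ≤ toℕ r′
rest-apart {b = b} {S} rest t r r₀ r<r₀ tr tr₀ =
  ≮⇒≥ (λ close → not-near r₀ (<-wellFounded r₀) r<r₀ close tr₀)
  where
  not-near : (r′ : Fin (length S)) → Acc _<ᶠ_ r′ →
             toℕ r < toℕ r′ → toℕ r′ < toℕ r + suc b → ¬ Involves t (lookup S r′)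
  not-near r′ (acc smaller) r<r′ r′<r+b′ tr′ =
    <⇒≱ (strictly-between-< (toℕ r) (toℕ r′) b r<r′ r′<r+b′) (rest r r′ t r<r′ tr tr′ between-free)
    where
    between-free : ∀ r″ → toℕ r < toℕ r″ → toℕ r″ < toℕ r′ → ¬ Involves t (lookup S r″)
    between-free r″ r<r″ r″<r′ = not-near r″ (smaller r″<r′) r<r″ (<-trans r″<r′ r′<r+b′)

module IdleTime {n : ℕ} (S : List (Game n)) (t : Fin n) where

  idleBefore : ℕ → ℕ
  idleBefore m = gapRev (reverse (take m S)) t

  idle-step : (i : Fin (length S)) → idleBefore (suc (toℕ i)) ≡
              (if involves? t (lookup S i) then 0 else suc (idleBefore (toℕ i)))
  idle-step i rewrite take-suc S i | reverse-++ (take (toℕ i) S) [ lookup S i ] = refl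

  idle-reset : (i : Fin (length S)) → Involves t (lookup S i) → idleBefore (suc (toℕ i)) ≡ 0
  idle-reset i ti rewrite idle-step i | involves?-true ti = refl

  idle-pass : ∀ m (m<L : m < length S) → ¬ Involves t (lookup S (fromℕ< m<L)) →
              idleBefore (suc m) ≡ suc (idleBefore m)
  idle-pass m m<L ¬ti = subst (λ x → idleBefore (suc x) ≡ suc (idleBefore x)) (FP.toℕ-fromℕ< m<L)
    (trans (idle-step (fromℕ< m<L)) (cong (if_then 0 else suc (idleBefore (toℕ (fromℕ< m<L)))) (involves?-false ¬ti)))

  idle-run : ∀ {m e} → m ≤ e → e ≤ length S → Absent S t m e → idleBefore e ≡ e ∸ m + idleBefore m
  idle-run {m} {e} m≤e e≤L absent =
    subst (λ x → idleBefore x ≡ e ∸ m + idleBefore m) (m∸n+n≡m m≤e)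
      (idle-skip (e ∸ m) (subst (_≤ length S) (sym (m∸n+n≡m m≤e)) e≤L)
        (subst (Absent S t m) (sym (m∸n+n≡m m≤e)) absent))
    where
    idle-skip : ∀ d → d + m ≤ length S → Absent S t m (d + m) → idleBefore (d + m) ≡ d + idleBefore m
    idle-skip zero _ _ = refl
    idle-skip (suc d) d+m<L absent′ = begin
      idleBefore (suc (d + m)) ≡⟨ idle-pass (d + m) d+m<L (absent′ _ m≤pos pos<) ⟩
      suc (idleBefore (d + m)) ≡⟨ cong suc (idle-skip d (<⇒≤ d+m<L) shorter) ⟩
      suc (d + idleBefore m)   ∎
      where
      m≤pos : m ≤ toℕ (fromℕ< d+m<L)
      m≤pos = subst (m ≤_) (sym (FP.toℕ-fromℕ< d+m<L)) (m≤n+m m d)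
      pos< : toℕ (fromℕ< d+m<L) < suc d + m
      pos< = subst (_< suc d + m) (sym (FP.toℕ-fromℕ< d+m<L)) (n<1+n (d + m))
      shorter : Absent S t m (d + m)
      shorter r m≤r r<d+m = absent′ r m≤r (m<n⇒m<1+n r<d+m)

  idle-fresh : ∀ {m} → m ≤ length S → Absent S t 0 m → idleBefore m ≡ m
  idle-fresh {m} m≤L absent = trans (idle-run z≤n m≤L absent) (+-identityʳ m)

module RestTimeKMinusOne (k : ℕ) (S : List (Game (2 * suc k + 1)))
                         (schedule : IsSchedule S) (rest : RestAtLeast k S) where
  open IsSchedule schedule
  open IdleTime S

  K : ℕ
  K = suc k

  L : ℕ
  L = length S

  game : Fin L → Game (2 * K + 1)
  game = lookup S

  normal : (p : Fin L) → proj₁ (game p) <ᶠ proj₂ (game p)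
  normal p = All.lookup normalised (∈-lookup p)

  proper : (p : Fin L) → proj₁ (game p) ≢ proj₂ (game p)
  proper p = FP.<⇒≢ (normal p)

  distinct-positions : {p p′ : Fin L} → p ≢ p′ → game p ≢ game p′
  distinct-positions = unique-lookup distinct _ _

  window-disjoint : ∀ s {r r′} → r ≢ r′ → s ≤ toℕ r → toℕ r < s + K → s ≤ toℕ r′ → toℕ r′ < s + K →
                    Disjoint (game r) (game r′)
  window-disjoint s {r} {r′} r≢r′ s≤r r<s+K s≤r′ r′<s+K t tr tr′ with <-cmp (toℕ r) (toℕ r′)
  ... | tri≈ _ e _ = r≢r′ (FP.toℕ-injective e)
  ... | tri< r<r′ _ _ = <⇒≱ (within-window s≤r r′<s+K) (rest-apart {S = S} rest t r r′ r<r′ tr tr′)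
  ... | tri> _ _ r′<r = <⇒≱ (within-window s≤r′ r<s+K) (rest-apart {S = S} rest t r′ r r′<r tr′ tr)

  absent-before : ∀ {t j} → Involves t (game j) → ∀ s → toℕ j < s + K → Absent S t s (toℕ j)
  absent-before {t} {j} tj s j<s+K r s≤r r<j =
    window-disjoint s (FP.<⇒≢ r<j ∘′ sym) (≤-trans s≤r (<⇒≤ r<j)) j<s+K s≤r (<-trans r<j j<s+K) t tj

  absent-cons : ∀ {t e} (q : Fin L) → ¬ Involves t (game q) → Absent S t (suc (toℕ q)) e → Absent S t (toℕ q) e
  absent-cons q t∉q absent r q≤r r<e with m≤n⇒m<n∨m≡n q≤r
  ... | inj₁ q<r = absent r q<r r<e
  ... | inj₂ q≡r = subst (λ x → ¬ Involves _ (game x)) (FP.toℕ-injective q≡r) t∉q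

  absent-since : ∀ {t} (q p : Fin L) → toℕ p ≤ toℕ q + K →
                 Involves t (game p) → ¬ Involves t (game q) → Absent S t (toℕ q) (toℕ p)
  absent-since q p p≤q+K t∈p t∉q = absent-cons q t∉q (absent-before t∈p (suc (toℕ q)) (s≤s p≤q+K))

  -- Counting on 2K+1 teams: no K consecutive games all miss two distinct teams u and v,
  -- since those games and the pair (u , v) would be K+1 disjoint games.
  crowded : ∀ s → s + K ≤ L → {u v : Fin (2 * K + 1)} → u ≢ v →
            Absent S u s (s + K) → Absent S v s (s + K) → ⊥
  crowded s s+K≤L {u} {v} u≢v u-absent v-absent =
    <⇒≱ teams<2K+2 (disjoint-games-bound family family-proper family-disjoint)
    where
    slot : Fin K → Fin L
    slot a = fromℕ< (<-≤-trans (+-monoʳ-< s (FP.toℕ<n a)) s+K≤L)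

    slot-pos : ∀ a → toℕ (slot a) ≡ s + toℕ a
    slot-pos a = FP.toℕ-fromℕ< _

    slot-lo : ∀ a → s ≤ toℕ (slot a)
    slot-lo a = subst (s ≤_) (sym (slot-pos a)) (m≤m+n s (toℕ a))

    slot-hi : ∀ a → toℕ (slot a) < s + K
    slot-hi a = subst (_< s + K) (sym (slot-pos a)) (+-monoʳ-< s (FP.toℕ<n a))

    slot-injective : ∀ {a a′} → a ≢ a′ → slot a ≢ slot a′
    slot-injective a≢a′ e = a≢a′ (FP.toℕ-injective
      (+-cancelˡ-≡ s _ _ (trans (sym (slot-pos _)) (trans (cong toℕ e) (slot-pos _)))))

    family : Fin (suc K) → Game (2 * K + 1)
    family F.zero = u , v
    family (F.suc a) = game (slot a)

    family-proper : ∀ c → proj₁ (family c) ≢ proj₂ (family c)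
    family-proper F.zero = u≢v
    family-proper (F.suc a) = proper (slot a)

    pair-outside : ∀ a → Disjoint (u , v) (game (slot a))
    pair-outside a t (inj₁ refl) = u-absent (slot a) (slot-lo a) (slot-hi a)
    pair-outside a t (inj₂ refl) = v-absent (slot a) (slot-lo a) (slot-hi a)

    family-disjoint : ∀ {c c′} → c ≢ c′ → Disjoint (family c) (family c′)
    family-disjoint {F.zero} {F.zero} c≢c′ = ⊥-elim (c≢c′ refl)
    family-disjoint {F.zero} {F.suc a′} _ = pair-outside a′
    family-disjoint {F.suc a} {F.zero} _ t ta tuv = pair-outside a t tuv ta
    family-disjoint {F.suc a} {F.suc a′} c≢c′ =
      window-disjoint s (slot-injective (c≢c′ ∘′ cong F.suc)) (slot-lo a) (slot-hi a) (slot-lo a′) (slot-hi a′)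

    teams<2K+2 : 2 * K + 1 < suc K * 2
    teams<2K+2 = subst (_< suc K * 2) (+-comm 1 (2 * K)) (s≤s (s≤s (≤-reflexive (*-comm 2 K))))

  -- The game at position q + K shares a team with the game at position q:
  -- otherwise the games q, …, q+K−1 would all miss both teams of game q + K.
  shares-team : (q p : Fin L) → toℕ p ≡ toℕ q + K →
                Involves (proj₁ (game p)) (game q) ⊎ Involves (proj₂ (game p)) (game q)
  shares-team q p p≡q+K with involves-dec (proj₁ (game p)) (game q) | involves-dec (proj₂ (game p)) (game q)
  ... | yes a∈q | _ = inj₁ a∈q
  ... | no _ | yes b∈q = inj₂ b∈q
  ... | no a∉q | no b∉q =
    ⊥-elim (crowded (toℕ q) (subst (_≤ L) p≡q+K (<⇒≤ (FP.toℕ<n p))) (proper p)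
             (missing (inj₁ refl) a∉q) (missing (inj₂ refl) b∉q))
    where
    missing : ∀ {t} → Involves t (game p) → ¬ Involves t (game q) → Absent S t (toℕ q) (toℕ q + K)
    missing t∈p t∉q = subst (Absent S _ (toℕ q)) p≡q+K (absent-since q p (≤-reflexive p≡q+K) t∈p t∉q)

  idle-repeater : ∀ {x} (q p : Fin L) → toℕ p ≡ toℕ q + K →
                  Involves x (game p) → Involves x (game q) → idleBefore x (toℕ p) ≡ k
  idle-repeater {x} q p p≡q+K x∈p x∈q = begin
    idleBefore x (toℕ p)                             ≡⟨ idle-run x q<p (<⇒≤ (FP.toℕ<n p)) absent ⟩
    toℕ p ∸ suc (toℕ q) + idleBefore x (suc (toℕ q)) ≡⟨ cong₂ _+_ distance (idle-reset x q x∈q) ⟩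
    k + 0                                            ≡⟨ +-identityʳ k ⟩
    k                                                ∎
    where
    q<p : toℕ q < toℕ p
    q<p = subst (toℕ q <_) (sym p≡q+K) (m<m+n (toℕ q) z<s)
    absent : Absent S x (suc (toℕ q)) (toℕ p)
    absent = absent-before x∈p (suc (toℕ q)) (s≤s (≤-reflexive p≡q+K))
    distance : toℕ p ∸ suc (toℕ q) ≡ k
    distance = trans (cong (_∸ suc (toℕ q)) (trans p≡q+K (+-suc (toℕ q) k))) (m+n∸m≡n (toℕ q) k)

  zero-or-successor : (q : Fin L) → toℕ q ≡ 0 ⊎ Σ (Fin L) λ q′ → suc (toℕ q′) ≡ toℕ q
  zero-or-successor q with toℕ q in q≡
  ... | zero = inj₁ refl
  ... | suc q′ = inj₂ (fromℕ< q′<L , cong suc (FP.toℕ-fromℕ< q′<L))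
    where
    q′<L : q′ < L
    q′<L = <-trans (n<1+n q′) (subst (_< L) q≡ (FP.toℕ<n q))

  -- A team y of game p = q + K that plays none of q, …, p−1 played game q−1:
  -- otherwise the games q−1, …, p−2 would miss both y and a team z of game p−1
  -- that is not in game q−1 (the two games differ).
  played-before : ∀ {y} (q p : Fin L) → toℕ p ≡ toℕ q + K → (q′ : Fin L) → suc (toℕ q′) ≡ toℕ q →
                  Involves y (game p) → Absent S y (toℕ q) (toℕ p) → Involves y (game q′)
  played-before {y} q p p≡q+K q′ q′+1≡q y∈p y-absent with involves-dec y (game q′)
  ... | yes y∈q′ = y∈q′
  ... | no y∉q′ = ⊥-elim (crowded (toℕ q′) (<⇒≤ end<L) y≢z y-absent′ z-absent)
    where
    end≡ : toℕ q′ + K ≡ toℕ q + k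
    end≡ = trans (+-suc (toℕ q′) k) (cong (_+ k) q′+1≡q)

    end<p : toℕ q + k < toℕ p
    end<p = subst (toℕ q + k <_) (sym (trans p≡q+K (+-suc (toℕ q) k))) ≤-refl

    end<L : toℕ q′ + K < L
    end<L = subst (_< L) (sym end≡) (<-trans end<p (FP.toℕ<n p))

    -- the game p − 1
    last : Fin L
    last = fromℕ< end<L

    last-pos : toℕ last ≡ toℕ q′ + K
    last-pos = FP.toℕ-fromℕ< end<L

    q′<last : toℕ q′ < toℕ last
    q′<last = subst (toℕ q′ <_) (sym last-pos) (m<m+n (toℕ q′) z<s)

    outside : Σ (Fin (2 * K + 1)) λ z → Involves z (game last) × ¬ Involves z (game q′)
    outside = team-outside (game last) (game q′) (normal last) (normal q′)
                (distinct-positions (FP.<⇒≢ q′<last ∘′ sym))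

    z-absent : Absent S (proj₁ outside) (toℕ q′) (toℕ q′ + K)
    z-absent = subst (Absent S _ (toℕ q′)) last-pos
      (absent-since q′ last (≤-reflexive last-pos) (proj₁ (proj₂ outside)) (proj₂ (proj₂ outside)))

    y-absent′ : Absent S y (toℕ q′) (toℕ q′ + K)
    y-absent′ = absent-cons q′ y∉q′ λ r q′<r r<end →
      y-absent r (subst (_≤ toℕ r) q′+1≡q q′<r) (<-trans (subst (toℕ r <_) end≡ r<end) end<p)

    y≢z : y ≢ proj₁ outside
    y≢z refl = y-absent last (subst (toℕ q ≤_) (sym last≡) (m≤m+n (toℕ q) k))
                             (subst (_< toℕ p) (sym last≡) end<p) (proj₁ (proj₂ outside))
      where
      last≡ : toℕ last ≡ toℕ q + k
      last≡ = trans last-pos end≡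

  idle-other : ∀ {x y} (q p : Fin L) → toℕ p ≡ toℕ q + K → x ≢ y →
               Involves x (game p) → Involves y (game p) → Involves x (game q) → idleBefore y (toℕ p) ≡ K
  idle-other {x} {y} q p p≡q+K x≢y x∈p y∈p x∈q = begin
    idleBefore y (toℕ p)                 ≡⟨ idle-run y q≤p (<⇒≤ (FP.toℕ<n p)) y-absent ⟩
    toℕ p ∸ toℕ q + idleBefore y (toℕ q) ≡⟨ cong₂ _+_ distance idle-at-q ⟩
    K + 0                                ≡⟨ +-identityʳ K ⟩
    K                                    ∎
    where
    q≤p : toℕ q ≤ toℕ p
    q≤p = subst (toℕ q ≤_) (sym p≡q+K) (m≤m+n (toℕ q) K)

    distance : toℕ p ∸ toℕ q ≡ K
    distance = trans (cong (_∸ toℕ q) p≡q+K) (m+n∸m≡n (toℕ q) K)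

    -- y is not in game q, since that game would then have the same teams as game p.
    y∉q : ¬ Involves y (game q)
    y∉q y∈q = distinct-positions (FP.<⇒≢ (subst (toℕ q <_) (sym p≡q+K) (m<m+n (toℕ q) z<s)))
                (same-teams⇒≡ (game q) (game p) (normal q) (normal p) x≢y x∈q y∈q x∈p y∈p)

    y-absent : Absent S y (toℕ q) (toℕ p)
    y-absent = absent-since q p (≤-reflexive p≡q+K) y∈p y∉q

    idle-at-q : idleBefore y (toℕ q) ≡ 0
    idle-at-q with zero-or-successor q
    ... | inj₁ q≡0 = cong (idleBefore y) q≡0
    ... | inj₂ (q′ , q′+1≡q) = trans (cong (idleBefore y) (sym q′+1≡q))
            (idle-reset y q′ (played-before q p p≡q+K q′ q′+1≡q y∈p y-absent))

  home away : Fin L → Fin (2 * K + 1)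
  home p = proj₁ (game p)
  away p = proj₂ (game p)

  difference : Fin L → ℕ
  difference p = ∣ idle S p (home p) - idle S p (away p) ∣

  -- Before position K nobody has played, so both idle times are p.
  early-difference : (p : Fin L) → toℕ p < K → difference p ≡ 0
  early-difference p p<K = begin
    difference p      ≡⟨ cong₂ ∣_-_∣ (fresh (inj₁ refl)) (fresh (inj₂ refl)) ⟩
    ∣ toℕ p - toℕ p ∣ ≡⟨ ∣n-n∣≡0 (toℕ p) ⟩
    0                 ∎
    where
    fresh : ∀ {t} → Involves t (game p) → idleBefore t (toℕ p) ≡ toℕ p
    fresh t∈p = idle-fresh _ (<⇒≤ (FP.toℕ<n p)) (absent-before t∈p 0 p<K)

  late-difference : (q p : Fin L) → toℕ p ≡ toℕ q + K → difference p ≡ 1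
  late-difference q p p≡q+K with shares-team q p p≡q+K
  ... | inj₁ home∈q = begin
    difference p  ≡⟨ cong₂ ∣_-_∣ (idle-repeater q p p≡q+K (inj₁ refl) home∈q)
                                 (idle-other q p p≡q+K (proper p) (inj₁ refl) (inj₂ refl) home∈q) ⟩
    ∣ k - suc k ∣ ≡⟨ ∣n-1+n∣≡1 k ⟩
    1             ∎
  ... | inj₂ away∈q = begin
    difference p  ≡⟨ cong₂ ∣_-_∣ (idle-other q p p≡q+K (proper p ∘′ sym) (inj₂ refl) (inj₁ refl) away∈q)
                                 (idle-repeater q p p≡q+K (inj₂ refl) away∈q) ⟩
    ∣ suc k - k ∣ ≡⟨ ∣-∣-comm (suc k) k ⟩
    ∣ k - suc k ∣ ≡⟨ ∣n-1+n∣≡1 k ⟩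
    1             ∎

  difference-≤1 : RestDiffAtMost 1 S
  difference-≤1 p with toℕ p <? K
  ... | yes p<K = ≤-trans (≤-reflexive (early-difference p p<K)) z≤n
  ... | no p≮K = ≤-reflexive (late-difference q p p≡q+K)
    where
    q : Fin L
    q = fromℕ< (≤-<-trans (m∸n≤m (toℕ p) K) (FP.toℕ<n p))
    p≡q+K : toℕ p ≡ toℕ q + K
    p≡q+K = trans (sym (m∸n+n≡m (≮⇒≥ p≮K))) (cong (_+ K) (sym (FP.toℕ-fromℕ< _)))

  -- The schedule is longer than K: team 0 plays teams 1 and 2, and these two
  -- games cannot lie in one window of K games.
  K<L : K < L
  K<L = ≰⇒> λ L≤K → window-disjoint 0 i₁≢i₂ z≤n (<-≤-trans (FP.toℕ<n i₁) L≤K)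
                                               z≤n (<-≤-trans (FP.toℕ<n i₂) L≤K)
                                     team₀ (inj₁ (cong proj₁ (lookup-index m₁))) (inj₁ (cong proj₁ (lookup-index m₂)))
    where
    team₀ : Fin (2 * K + 1)
    team₀ = F.zero

    3≤N : 3 ≤ 2 * K + 1
    3≤N = +-monoˡ-≤ 1 (*-monoʳ-≤ 2 (s≤s z≤n))

    1<N : 1 < 2 * K + 1
    1<N = <-≤-trans (s≤s (s≤s z≤n)) 3≤N

    2<N : 2 < 2 * K + 1
    2<N = 3≤N

    zero<team : ∀ {i} (i<N : i < 2 * K + 1) → 0 < i → team₀ <ᶠ fromℕ< i<N
    zero<team i<N 0<i = subst (0 <_) (sym (FP.toℕ-fromℕ< i<N)) 0<i

    m₁ : (team₀ , fromℕ< 1<N) ∈ S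
    m₁ = complete team₀ (fromℕ< 1<N) (zero<team 1<N z<s)

    m₂ : (team₀ , fromℕ< 2<N) ∈ S
    m₂ = complete team₀ (fromℕ< 2<N) (zero<team 2<N z<s)

    i₁ i₂ : Fin L
    i₁ = Any.index m₁
    i₂ = Any.index m₂

    i₁≢i₂ : i₁ ≢ i₂
    i₁≢i₂ e with FP.fromℕ<-injective 1 2 1<N 2<N
                   (cong proj₂ (trans (lookup-index m₁) (trans (cong game e) (sym (lookup-index m₂)))))
    ... | ()

  -- The game at position K has difference 1, so no smaller bound holds.
  difference-≥1 : ∀ d → RestDiffAtMost d S → 1 ≤ d
  difference-≥1 d at-most-d = subst (_≤ d) (late-difference first pK pK≡) (at-most-d pK)
    where
    pK first : Fin L
    pK = fromℕ< K<L
    first = fromℕ< (≤-<-trans z≤n K<L)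
    pK≡ : toℕ pK ≡ toℕ first + K
    pK≡ = trans (FP.toℕ-fromℕ< K<L) (cong (_+ K) (sym (FP.toℕ-fromℕ< _)))

lemma4p3 : (k : ℕ) → 1 ≤ k → (S : List (Game (2 * k + 1))) → IsSchedule S →
           HasGuaranteedRestTime (k ∸ 1) S → HasRestDifferenceIndex 1 S
lemma4p3 (suc k) _ S schedule (rest , _) = difference-≤1 , difference-≥1
  where open RestTimeKMinusOne k S schedule rest
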